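{- Let $(L,\wedge,\vee,{}^{\triangle},{}^{\nabla},0,1)$ be a weakly dicomplemented lattice. Then $x^{\triangle}=x^{\nabla}$ for all $x\in L$ if and only if both $(L,\wedge,\vee,{}^{\triangle},0,1)$ and $(L,\wedge,\vee,{}^{\nabla},0,1)$ are Boolean algebras (with ${}^{\triangle}$, respectively ${}^{\nabla}$, as the complementation).
   Context: A weakly dicomplemented lattice is a bounded lattice $(L,\wedge,\vee,0,1)$ equipped with two unary operations ${}^{\triangle}$ and ${}^{\nabla}$ such that for all $x,y\in L$: (1) $x^{\triangle\triangle}\le x$; (2) $x\le y\implies x^{\triangle}\ge y^{\triangle}$; (3) $(x\wedge y)\vee(x\wedge y^{\triangle})=x$; (1') $x^{\nabla\nabla}\ge x$; (2') $x\le y\implies x^{\nabla}\ge y^{\nabla}$; (3') $(x\vee y)\wedge(x\vee y^{\nabla})=x$. Here $x^{\triangle\triangle}=(x^{\triangle})^{\triangle}$ and $x^{\nabla\nabla}=(x^{\nabla})^{\nabla}$. -}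

module Defs where

open import Level using (Level; suc; _⊔_)
open import Relation.Binary.Core using (Rel)
open import Algebra.Core using (Op₁; Op₂)
open import Algebra.Definitions using (Congruent₁)
open import Algebra.Lattice.Structures using (IsLattice; IsBooleanAlgebra)

record WeaklyDicomplementedLattice (c ℓ : Level) : Set (suc (c ⊔ ℓ)) where
  infixr 7 _∧_
  infixr 6 _∨_
  infix  4 _≈_ _≤_
  field
    Carrier   : Set c
    _≈_       : Rel Carrier ℓ
    _∨_       : Op₂ Carrier
    _∧_       : Op₂ Carrier
    △         : Op₁ Carrier
    ∇         : Op₁ Carrier
    𝟘         : Carrier
    𝟙         : Carrier
    isLattice : IsLattice _≈_ _∨_ _∧_

  _≤_ : Rel Carrier ℓ
  x ≤ y = (x ∧ y) ≈ x

  field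
    𝟘-least    : ∀ x → 𝟘 ≤ x
    𝟙-greatest : ∀ x → x ≤ 𝟙
    △-cong     : Congruent₁ _≈_ △
    ∇-cong     : Congruent₁ _≈_ ∇
    △△-≤       : ∀ x → △ (△ x) ≤ x
    △-antitone : ∀ {x y} → x ≤ y → △ y ≤ △ x
    △-split    : ∀ x y → ((x ∧ y) ∨ (x ∧ △ y)) ≈ x
    ∇∇-≥       : ∀ x → x ≤ ∇ (∇ x)
    ∇-antitone : ∀ {x y} → x ≤ y → ∇ y ≤ ∇ x
    ∇-split    : ∀ x y → ((x ∨ y) ∧ (x ∨ ∇ y)) ≈ x

  open IsLattice isLattice public

-- If △ = ∇, axiom (3') at 𝟘 gives x ∧ x△ = 𝟘 and axiom (3) gives x ≤ y△ whenever
-- x ∧ y = 𝟘, so △ is a pseudocomplement; (1) and (1') squeeze x△△ = x.  An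
-- involutive pseudocomplement forces distributivity and x ∨ x△ = 𝟙.
-- Conversely, complements in a Boolean algebra are unique, and x∇ is one.
module Submission where

open import Defs
open import Data.Product using (_×_; _,_)
open import Function.Bundles using (_⇔_; mk⇔)
open import Relation.Binary.Core using (Rel)
open import Relation.Binary.Bundles using (Poset)
open import Algebra.Core using (Op₁; Op₂)
open import Algebra.Lattice.Bundles using (Lattice; BooleanAlgebra)
open import Algebra.Lattice.Structures using (IsBooleanAlgebra)
import Algebra.Lattice.Structures.Biased as Biased
import Algebra.Lattice.Properties.Lattice as LatticeProperties
import Algebra.Lattice.Properties.DistributiveLattice as DistributiveLatticeProperties
import Algebra.Lattice.Properties.BooleanAlgebra as BooleanAlgebraProperties
import Relation.Binary.Lattice as OrderLattice
import Relation.Binary.Lattice.Properties.MeetSemilattice as MeetSemilatticeProperties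
import Relation.Binary.Lattice.Properties.JoinSemilattice as JoinSemilatticeProperties
import Relation.Binary.Properties.Poset as PosetProperties
import Relation.Binary.Reasoning.Setoid as SetoidReasoning

module _ {a ℓ} {A : Set a} {_≈_ : Rel A ℓ} {_∨_ _∧_ : Op₂ A} {⊤ ⊥ : A} where

  isBooleanAlgebra-resp-¬ : ∀ {¬ ¬′ : Op₁ A} → IsBooleanAlgebra _≈_ _∨_ _∧_ ¬ ⊤ ⊥ →
                            (∀ x → ¬ x ≈ ¬′ x) → IsBooleanAlgebra _≈_ _∨_ _∧_ ¬′ ⊤ ⊥
  isBooleanAlgebra-resp-¬ B ¬≈¬′ = Biased.isBooleanAlgebraʳ record
    { isDistributiveLattice = isDistributiveLattice
    ; ∨-complementʳ         = λ x → trans (∨-congˡ (sym (¬≈¬′ x))) (∨-complementʳ x)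
    ; ∧-complementʳ         = λ x → trans (∧-congˡ (sym (¬≈¬′ x))) (∧-complementʳ x)
    ; ¬-cong                = λ {x} {y} x≈y → trans (sym (¬≈¬′ x)) (trans (¬-cong x≈y) (¬≈¬′ y))
    }
    where open IsBooleanAlgebra B

  complement-unique : ∀ {¬ : Op₁ A} → IsBooleanAlgebra _≈_ _∨_ _∧_ ¬ ⊤ ⊥ →
                      ∀ {x y} → (x ∧ y) ≈ ⊥ → (x ∨ y) ≈ ⊤ → ¬ x ≈ y
  complement-unique {¬} B {x} {y} x∧y≈⊥ x∨y≈⊤ = begin
    ¬ x                    ≈⟨ ∧-identityʳ _ ⟨
    ¬ x ∧ ⊤                ≈⟨ ∧-congˡ x∨y≈⊤ ⟨
    ¬ x ∧ (x ∨ y)          ≈⟨ ∧-distribˡ-∨ _ _ _ ⟩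
    (¬ x ∧ x) ∨ (¬ x ∧ y)  ≈⟨ ∨-congʳ (∧-complementˡ _) ⟩
    ⊥ ∨ (¬ x ∧ y)          ≈⟨ ∨-congʳ x∧y≈⊥ ⟨
    (x ∧ y) ∨ (¬ x ∧ y)    ≈⟨ ∧-distribʳ-∨ _ _ _ ⟨
    (x ∨ ¬ x) ∧ y          ≈⟨ ∧-congʳ (∨-complementʳ _) ⟩
    ⊤ ∧ y                  ≈⟨ ∧-identityˡ _ ⟩
    y                      ∎
    where
    BA : BooleanAlgebra a ℓ
    BA = record { isBooleanAlgebra = B }
    open BooleanAlgebra BA using (setoid; ∧-congˡ; ∧-congʳ; ∨-congʳ; ∧-distribˡ-∨; ∧-distribʳ-∨;
                                  ∧-complementˡ; ∨-complementʳ)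
    open BooleanAlgebraProperties BA using (∧-identityˡ; ∧-identityʳ)
    open SetoidReasoning setoid

module PseudocomplementedLattice {c ℓ} (L : Lattice c ℓ) where
  open Lattice L
  open LatticeProperties L using (∧-∨-isLattice; ∨-∧-orderTheoreticLattice)
  open OrderLattice.Lattice ∨-∧-orderTheoreticLattice
    using (_≤_; poset; meetSemilattice; x∧y≤x; x∧y≤y; ∧-greatest; x≤x∨y; y≤x∨y; ∨-least)
  open Poset poset using (antisym) renaming (reflexive to ≤-reflexive; refl to ≤-refl; trans to ≤-trans)
  open PosetProperties poset using (antimono⇒cong)
  open MeetSemilatticeProperties meetSemilattice using (∧-monotonic)

  module _ (¬_ : Op₁ Carrier) (⊥ ⊤ : Carrier)
           (⊥-minimum : ∀ x → ⊥ ≤ x) (⊤-maximum : ∀ x → x ≤ ⊤)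
           (¬-disjoint : ∀ x → x ∧ ¬ x ≈ ⊥)
           (disjoint⇒≤¬ : ∀ {x y} → x ∧ y ≈ ⊥ → x ≤ ¬ y) where

    ≤⊥⇒≈⊥ : ∀ {x} → x ≤ ⊥ → x ≈ ⊥
    ≤⊥⇒≈⊥ {x} x≤⊥ = antisym x≤⊥ (⊥-minimum x)

    ≤∧≤¬⇒≈⊥ : ∀ {x y} → x ≤ y → x ≤ ¬ y → x ≈ ⊥
    ≤∧≤¬⇒≈⊥ {y = y} x≤y x≤¬y = ≤⊥⇒≈⊥ (≤-trans (∧-greatest x≤y x≤¬y) (≤-reflexive (¬-disjoint y)))

    ≤¬⇒disjoint : ∀ {x y} → x ≤ ¬ y → x ∧ y ≈ ⊥
    ≤¬⇒disjoint x≤¬y = ≤∧≤¬⇒≈⊥ (x∧y≤y _ _) (≤-trans (x∧y≤x _ _) x≤¬y)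

    ≤¬-swap : ∀ {x y} → x ≤ ¬ y → y ≤ ¬ x
    ≤¬-swap {x} {y} x≤¬y = disjoint⇒≤¬ (trans (∧-comm y x) (≤¬⇒disjoint x≤¬y))

    ¬⊥≈⊤ : ¬ ⊥ ≈ ⊤
    ¬⊥≈⊤ = antisym (⊤-maximum _) (disjoint⇒≤¬ (≤⊥⇒≈⊥ (x∧y≤y ⊤ ⊥)))

    ¬∧¬≤¬∨ : ∀ x y → ¬ x ∧ ¬ y ≤ ¬ (x ∨ y)
    ¬∧¬≤¬∨ x y = ≤¬-swap (∨-least (≤¬-swap (x∧y≤x _ _)) (≤¬-swap (x∧y≤y _ _)))

    module _ (¬-involutive : ∀ x → ¬ ¬ x ≈ x) where

      disjoint⇒≤ : ∀ {x y} → x ∧ ¬ y ≈ ⊥ → x ≤ y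
      disjoint⇒≤ {y = y} x∧¬y≈⊥ = ≤-trans (disjoint⇒≤¬ x∧¬y≈⊥) (≤-reflexive (¬-involutive y))

      ¬-antitone : ∀ {x y} → x ≤ y → ¬ y ≤ ¬ x
      ¬-antitone {y = y} x≤y = ≤¬-swap (≤-trans x≤y (≤-reflexive (sym (¬-involutive y))))

      ∨-complementʳ : ∀ x → x ∨ ¬ x ≈ ⊤
      ∨-complementʳ x = begin
        x ∨ ¬ x          ≈⟨ ¬-involutive _ ⟨
        ¬ ¬ (x ∨ ¬ x)    ≈⟨ antimono⇒cong ¬-antitone ¬[x∨¬x]≈⊥ ⟩
        ¬ ⊥              ≈⟨ ¬⊥≈⊤ ⟩
        ⊤                ∎
        where
        open SetoidReasoning setoid
        ¬[x∨¬x]≈⊥ : ¬ (x ∨ ¬ x) ≈ ⊥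
        ¬[x∨¬x]≈⊥ = ≤∧≤¬⇒≈⊥ (¬-antitone (x≤x∨y _ _)) (¬-antitone (y≤x∨y _ _))

      -- With d = (y ∧ x) ∨ (z ∧ x), the part of (y ∨ z) ∧ x outside d is disjoint
      -- from y and from z, hence lies below ¬ y ∧ ¬ z ≤ ¬ (y ∨ z) and below y ∨ z.
      ∧-distribʳ-∨ : ∀ x y z → (y ∨ z) ∧ x ≈ (y ∧ x) ∨ (z ∧ x)
      ∧-distribʳ-∨ x y z = antisym (disjoint⇒≤ g≈⊥)
        (∨-least (∧-monotonic (x≤x∨y y z) ≤-refl) (∧-monotonic (y≤x∨y y z) ≤-refl))
        where
        d g : Carrier
        d = (y ∧ x) ∨ (z ∧ x)
        g = ((y ∨ z) ∧ x) ∧ ¬ d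

        g≤x : g ≤ x
        g≤x = ≤-trans (x∧y≤x _ _) (x∧y≤y _ _)

        g≤¬ : ∀ {w} → w ∧ x ≤ d → g ≤ ¬ w
        g≤¬ w∧x≤d = disjoint⇒≤¬ (≤∧≤¬⇒≈⊥
          (≤-trans (∧-greatest (x∧y≤y _ _) (≤-trans (x∧y≤x _ _) g≤x)) w∧x≤d)
          (≤-trans (x∧y≤x _ _) (x∧y≤y _ _)))

        g≈⊥ : g ≈ ⊥
        g≈⊥ = ≤∧≤¬⇒≈⊥ (≤-trans (x∧y≤x _ _) (x∧y≤x _ _))
          (≤-trans (∧-greatest (g≤¬ (x≤x∨y _ _)) (g≤¬ (y≤x∨y _ _))) (¬∧¬≤¬∨ y z))

      involutive⇒isBooleanAlgebra : IsBooleanAlgebra _≈_ _∨_ _∧_ ¬_ ⊤ ⊥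
      involutive⇒isBooleanAlgebra = Biased.isBooleanAlgebraʳ record
        { isDistributiveLattice = DistributiveLatticeProperties.∧-∨-isDistributiveLattice
            record { isDistributiveLattice = Biased.isDistributiveLatticeʳʲᵐ record
              { isLattice = ∧-∨-isLattice ; ∨-distribʳ-∧ = ∧-distribʳ-∨ } }
        ; ∨-complementʳ         = ∨-complementʳ
        ; ∧-complementʳ         = ¬-disjoint
        ; ¬-cong                = antimono⇒cong ¬-antitone
        }

-- The structure's order x ∧ y ≈ x is the symmetric form of the standard
-- library's natural order x ≈ x ∧ y used here, so its axioms convert by sym.
module WeaklyDicomplemented {c ℓ} (L : WeaklyDicomplementedLattice c ℓ) where
  open WeaklyDicomplementedLattice L hiding (_≤_)

  lattice : Lattice c ℓ
  lattice = record { isLattice = isLattice }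

  open LatticeProperties lattice using (∨-∧-orderTheoreticLattice)
  open OrderLattice.Lattice ∨-∧-orderTheoreticLattice using (_≤_; poset; joinSemilattice)
  open Poset poset using (antisym)
  open JoinSemilatticeProperties joinSemilattice using (x≤y⇒x∨y≈y)
  open SetoidReasoning (Lattice.setoid lattice)

  𝟘-identityˡ : ∀ x → 𝟘 ∨ x ≈ x
  𝟘-identityˡ x = x≤y⇒x∨y≈y (sym (𝟘-least x))

  ∧-∇-disjoint : ∀ x → x ∧ ∇ x ≈ 𝟘
  ∧-∇-disjoint x = begin
    x ∧ ∇ x              ≈⟨ ∧-cong (𝟘-identityˡ x) (𝟘-identityˡ (∇ x)) ⟨
    (𝟘 ∨ x) ∧ (𝟘 ∨ ∇ x)  ≈⟨ ∇-split 𝟘 x ⟩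
    𝟘                    ∎

  disjoint⇒≤△ : ∀ {x y} → x ∧ y ≈ 𝟘 → x ≤ △ y
  disjoint⇒≤△ {x} {y} x∧y≈𝟘 = begin
    x                    ≈⟨ △-split x y ⟨
    (x ∧ y) ∨ (x ∧ △ y)  ≈⟨ ∨-congʳ x∧y≈𝟘 ⟩
    𝟘 ∨ (x ∧ △ y)        ≈⟨ 𝟘-identityˡ _ ⟩
    x ∧ △ y              ∎

  module _ (△≈∇ : ∀ x → △ x ≈ ∇ x) where

    △-involutive : ∀ x → △ (△ x) ≈ x
    △-involutive x = antisym (sym (△△-≤ x)) (begin
      x                ≈⟨ ∇∇-≥ x ⟨
      x ∧ ∇ (∇ x)      ≈⟨ ∧-congˡ (∇-cong (△≈∇ x)) ⟨
      x ∧ ∇ (△ x)      ≈⟨ ∧-congˡ (△≈∇ (△ x)) ⟨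
      x ∧ △ (△ x)      ∎)

    △-isBooleanAlgebra : IsBooleanAlgebra _≈_ _∨_ _∧_ △ 𝟙 𝟘
    △-isBooleanAlgebra = PseudocomplementedLattice.involutive⇒isBooleanAlgebra lattice △ 𝟘 𝟙
      (λ x → sym (𝟘-least x)) (λ x → sym (𝟙-greatest x))
      (λ x → trans (∧-congˡ (△≈∇ x)) (∧-∇-disjoint x)) disjoint⇒≤△ △-involutive

theorem2 : ∀ {c ℓ} (L : WeaklyDicomplementedLattice c ℓ) →
    let open WeaklyDicomplementedLattice L in
    (∀ x → △ x ≈ ∇ x) ⇔
    (IsBooleanAlgebra _≈_ _∨_ _∧_ △ 𝟙 𝟘 × IsBooleanAlgebra _≈_ _∨_ _∧_ ∇ 𝟙 𝟘)
theorem2 L = mk⇔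
  (λ △≈∇ → △-isBooleanAlgebra △≈∇ , isBooleanAlgebra-resp-¬ (△-isBooleanAlgebra △≈∇) △≈∇)
  (λ (△-boolean , ∇-boolean) x →
    complement-unique △-boolean (∧-complementʳ ∇-boolean x) (∨-complementʳ ∇-boolean x))
  where
  open WeaklyDicomplemented L
  open IsBooleanAlgebra using (∧-complementʳ; ∨-complementʳ)
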